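{- Let $P$ be a finite poset and $X$ an ideal in $(\mathcal{C}(P),\preceq)$. If for every $r\ge1$ the set $X$ contains an $r$-rich coloring, then $|X_n|\ge n$ for all $n\ge 1$.
   Context: $\mathcal{C}(P)$ is the set of colorings $(n,\chi)$, $n\in\mathbb{N}_0$, $\chi:\binom{[n]}{2}\to P$; $(m,\psi)\preceq(n,\chi)$ iff some increasing $f:[m]\to[n]$ has $\psi(\{i,j\})\le_P\chi(\{f(i),f(j)\})$ for all $i<j$. An ideal is a down-closed subset; $X_n=\{(n,\chi)\in X\}$. The reversal of $(n,\chi)$ is $(n,\psi)$ with $\psi(\{i,j\})=\chi(\{n-i+1,n-j+1\})$. For an integer $r\ge1$, a coloring $(n,\chi)$ is $r$-rich if $n=2r-1$ and either (type 1) in $(n,\chi)$ or in its reversal, $\chi(\{i,i+1\})=a$ for $1\le i\le r-1$ and $\chi(\{r,r+1\})=b$ for two colors $a\ne b$; or (type 2) in $(n,\chi)$ or in its reversal, $\chi(\{1,i\})=a$ for $2\le i\le r$ and $\chi(\{1,r+1\})=b$ for two colors $a\neq b$. No restriction is imposed on the other edges. -}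

module Defs where

open import Level using (0ℓ)
open import Data.Nat as ℕ using (ℕ; zero; suc; _+_; _*_; _∸_)
open import Data.Fin using (Fin; toℕ; opposite; _<_)
open import Data.Product using (Σ; _×_; ∃; ∃-syntax; _,_)
open import Relation.Binary.Core using (Rel)
open import Relation.Binary.PropositionalEquality using (_≡_; _≢_)

-- Vertices are Fin n (0-based); χ i j is the color of the pair {i, j}, and
-- only its values for i < j are meaningful (values for i ≥ j are ignored).
Coloring : ℕ → ℕ → Set
Coloring k n = Fin n → Fin n → Fin k

_≈C_ : ∀ {k n} → Coloring k n → Coloring k n → Set
ψ ≈C χ = ∀ i j → i < j → ψ i j ≡ χ i j

Embeds : ∀ {k} → Rel (Fin k) 0ℓ → ∀ {m n} → Coloring k m → Coloring k n → Set
Embeds _≤P_ {m} {n} ψ χ =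
  Σ (Fin m → Fin n) λ f → ((∀ (i j : Fin m) → i < j → f i < f j)
         × (∀ (i j : Fin m) → i < j → ψ i j ≤P χ (f i) (f j)))

IsIdeal : ∀ {k} → Rel (Fin k) 0ℓ → (∀ n → Coloring k n → Set) → Set
IsIdeal _≤P_ X = ∀ m n (ψ : Coloring _ m) (χ : Coloring _ n) →
  Embeds _≤P_ ψ χ → X n χ → X m ψ

-- Reversal: ψ({i,j}) = χ({n-i+1, n-j+1}); for i < j the pair
-- {opposite i, opposite j} has opposite j < opposite i.
reversal : ∀ {k n} → Coloring k n → Coloring k n
reversal χ i j = χ (opposite j) (opposite i)

-- Type 1 (0-based): edges {i, i+1} with 0 ≤ i ≤ r-2 have color a,
-- the edge {r-1, r} has color b.
Type1 : ∀ {k n} → ℕ → Coloring k n → Set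
Type1 {k} {n} r χ = ∃[ a ] ∃[ b ] (a ≢ b
  × (∀ (i j : Fin n) → toℕ j ≡ suc (toℕ i) → suc (toℕ i) ℕ.< r → χ i j ≡ a)
  × (∀ (i j : Fin n) → suc (toℕ i) ≡ r → toℕ j ≡ r → χ i j ≡ b))

-- Type 2 (0-based): edges {0, j} with 1 ≤ j ≤ r-1 have color a,
-- the edge {0, r} has color b.
Type2 : ∀ {k n} → ℕ → Coloring k n → Set
Type2 {k} {n} r χ = ∃[ a ] ∃[ b ] (a ≢ b
  × (∀ (i j : Fin n) → toℕ i ≡ 0 → 1 ℕ.≤ toℕ j → toℕ j ℕ.< r → χ i j ≡ a)
  × (∀ (i j : Fin n) → toℕ i ≡ 0 → toℕ j ≡ r → χ i j ≡ b))

-- (n, χ) is r-rich (the requirement n = 2r - 1 is imposed by the caller).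
Rich : ∀ {k n} → ℕ → Coloring k n → Set
Rich r χ = Type1 r χ Data.Sum.⊎ Type1 r (reversal χ)
         Data.Sum.⊎ Type2 r χ Data.Sum.⊎ Type2 r (reversal χ)
  where import Data.Sum

{-# OPTIONS --safe #-}
-- Write r = m + 1 and take an r-rich ψ ∈ X on the vertices 0, …, 2m.  For t ≤ m the window of
-- r consecutive vertices starting at m − t restricts ψ to a member of X_r whose t-th vertex is
-- the middle vertex m.  If ψ has type 1, the local edge {t, t+1} of window t is the edge
-- {m, m+1}, of colour b, while in every window t' > t it is a path edge left of m, of colour a;
-- so the r windows are pairwise distinct.  Type 2 works the same way with the edges {0, t+1},
-- after moving the first vertex of every window to vertex 0.  The reversed types reduce to
-- these since X ∘ reversal is again an ideal.
module Submission where

open import Defs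
open import Level using (0ℓ)
open import Data.Nat using (ℕ; suc; _*_; _∸_; _≤_)
open import Data.Fin using (Fin)
open import Data.Product using (Σ; ∃-syntax; _×_)
open import Relation.Binary.Core using (Rel)
open import Relation.Binary.Structures using (IsPartialOrder)
open import Relation.Binary.PropositionalEquality using (_≡_; _≢_)
open import Relation.Nullary using (¬_)

open import Data.Nat as ℕ using (_+_; z≤n; s≤s)
import Data.Nat.Properties as ℕ
open import Data.Fin as Fin using (toℕ; fromℕ<; opposite)
import Data.Fin.Properties as Fin
open import Data.Product using (∃₂; _,_)
open import Data.Sum using (inj₁; inj₂)
open import Function using (_∘_)
open import Relation.Binary.Core using (_Preserves_⟶_)
open import Relation.Binary.Definitions using (Reflexive; tri<; tri≈; tri>)
open import Relation.Binary.PropositionalEquality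
  using (refl; sym; trans; cong; cong₂; subst; subst₂; module ≡-Reasoning)

embed : ∀ {n N} (p : Fin n → ℕ) → (∀ i → p i ℕ.< N) → Fin n → Fin N
embed p p<N i = fromℕ< (p<N i)

toℕ-embed : ∀ {n N} (p : Fin n → ℕ) (p<N : ∀ i → p i ℕ.< N) i → toℕ (embed p p<N i) ≡ p i
toℕ-embed p p<N i = Fin.toℕ-fromℕ< (p<N i)

embed-mono : ∀ {n N} (p : Fin n → ℕ) (p<N : ∀ i → p i ℕ.< N) →
  p Preserves Fin._<_ ⟶ ℕ._<_ → embed p p<N Preserves Fin._<_ ⟶ Fin._<_
embed-mono p p<N p-mono {i} {j} i<j =
  subst₂ ℕ._<_ (sym (toℕ-embed p p<N i)) (sym (toℕ-embed p p<N j)) (p-mono i<j)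

successor : ∀ {n} {i j : Fin n} → i Fin.< j → Fin n
successor {j = j} i<j = fromℕ< (ℕ.≤-<-trans i<j (Fin.toℕ<n j))

toℕ-successor : ∀ {n} {i j : Fin n} (i<j : i Fin.< j) → toℕ (successor i<j) ≡ suc (toℕ i)
toℕ-successor {j = j} i<j = Fin.toℕ-fromℕ< (ℕ.≤-<-trans i<j (Fin.toℕ<n j))

opposite-reverses-< : ∀ {n} {i j : Fin n} → i Fin.< j → opposite j Fin.< opposite i
opposite-reverses-< {i = i} {j} i<j =
  subst₂ ℕ._<_ (sym (Fin.opposite-prop j)) (sym (Fin.opposite-prop i))
    (ℕ.∸-monoʳ-< (s≤s i<j) (Fin.toℕ<n j))

restrict : ∀ {k m n} → Coloring k m → (Fin n → Fin m) → Coloring k n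
restrict ψ g i j = ψ (g i) (g j)

Separated : ∀ {k n} → Coloring k n → Coloring k n → Set
Separated ψ χ = ∃₂ λ i j → i Fin.< j × ψ i j ≢ χ i j

separated⇒≉ : ∀ {k n} {ψ χ : Coloring k n} → Separated ψ χ → ¬ (ψ ≈C χ)
separated⇒≉ (i , j , i<j , ψij≢χij) ψ≈χ = ψij≢χij (ψ≈χ i j i<j)

reversal-involutive : ∀ {k n} (χ : Coloring k n) i j → reversal (reversal χ) i j ≡ χ i j
reversal-involutive χ i j = cong₂ χ (Fin.opposite-involutive i) (Fin.opposite-involutive j)

reversal-reflects-≈C : ∀ {k n} {ψ χ : Coloring k n} → reversal ψ ≈C reversal χ → ψ ≈C χ
reversal-reflects-≈C {ψ = ψ} {χ} rψ≈rχ i j i<j = begin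
  ψ i j                           ≡⟨ reversal-involutive ψ i j ⟨
  reversal (reversal ψ) i j       ≡⟨ rψ≈rχ (opposite j) (opposite i) (opposite-reverses-< i<j) ⟩
  reversal (reversal χ) i j       ≡⟨ reversal-involutive χ i j ⟩
  χ i j                           ∎
  where open ≡-Reasoning

LargeSlice : ∀ {k} → (∀ n → Coloring k n → Set) → ℕ → Set
LargeSlice {k} X n = Σ (Fin n → Coloring k n) λ f → ((∀ (i : Fin n) → X n (f i))
    × (∀ (i j : Fin n) → i ≢ j → ¬ (f i ≈C f j)))

Reversed : ∀ {k} → (∀ n → Coloring k n → Set) → ∀ n → Coloring k n → Set
Reversed X n χ = X n (reversal χ)

largeSlice-unreverse : ∀ {k X n} → LargeSlice {k} (Reversed X) n → LargeSlice X n
largeSlice-unreverse (f , f∈X , f-distinct) =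
  (λ t → reversal (f t)) , f∈X , λ t t' t≢t' → f-distinct t t' t≢t' ∘ reversal-reflects-≈C

module Windows (m : ℕ) where

  position : Fin (suc m) → Fin (suc m) → ℕ
  position t i = m ∸ toℕ t + toℕ i

  pinnedPosition : Fin (suc m) → Fin (suc m) → ℕ
  pinnedPosition t Fin.zero    = 0
  pinnedPosition t (Fin.suc i) = position t (Fin.suc i)

  position<2r-1 : ∀ t i → position t i ℕ.< 2 * suc m ∸ 1
  position<2r-1 t i = ℕ.≤-<-trans (ℕ.+-mono-≤ (ℕ.m∸n≤m m (toℕ t)) (Fin.toℕ≤pred[n] i))
                                  (ℕ.+-monoʳ-< m (ℕ.m≤m+n (suc m) 0))

  pinnedPosition≤position : ∀ t i → pinnedPosition t i ≤ position t i
  pinnedPosition≤position t Fin.zero    = z≤n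
  pinnedPosition≤position t (Fin.suc i) = ℕ.≤-refl

  pinnedPosition<2r-1 : ∀ t i → pinnedPosition t i ℕ.< 2 * suc m ∸ 1
  pinnedPosition<2r-1 t i = ℕ.≤-<-trans (pinnedPosition≤position t i) (position<2r-1 t i)

  position-mono : ∀ t → position t Preserves Fin._<_ ⟶ ℕ._<_
  position-mono t = ℕ.+-monoʳ-< (m ∸ toℕ t)

  pinnedPosition-mono : ∀ t → pinnedPosition t Preserves Fin._<_ ⟶ ℕ._<_
  pinnedPosition-mono t {Fin.zero}  {Fin.suc j} _   =
    ℕ.<-≤-trans (s≤s z≤n) (ℕ.m≤n+m (suc (toℕ j)) (m ∸ toℕ t))
  pinnedPosition-mono t {Fin.suc i} {Fin.suc j} i<j = position-mono t i<j

  window : Fin (suc m) → Fin (suc m) → Fin (2 * suc m ∸ 1)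
  window t = embed (position t) (position<2r-1 t)

  pinnedWindow : Fin (suc m) → Fin (suc m) → Fin (2 * suc m ∸ 1)
  pinnedWindow t = embed (pinnedPosition t) (pinnedPosition<2r-1 t)

  position-self : ∀ t → position t t ≡ m
  position-self t = ℕ.m∸n+n≡m (Fin.toℕ≤pred[n] t)

  position-earlier : ∀ {t t'} → t Fin.< t' → position t' t ℕ.< m
  position-earlier {t} {t'} t<t' =
    subst (position t' t ℕ.<_) (position-self t') (position-mono t' t<t')

  position-successor : ∀ t {u u'} (u<u' : u Fin.< u') → position t (successor u<u') ≡ suc (position t u)
  position-successor t {u} u<u' = begin
    m ∸ toℕ t + toℕ (successor u<u')  ≡⟨ cong (m ∸ toℕ t +_) (toℕ-successor u<u') ⟩
    m ∸ toℕ t + suc (toℕ u)           ≡⟨ ℕ.+-suc (m ∸ toℕ t) (toℕ u) ⟩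
    suc (position t u)                ∎
    where open ≡-Reasoning

  pinnedPosition-successor : ∀ t {u u'} (u<u' : u Fin.< u') →
    pinnedPosition t (successor u<u') ≡ suc (position t u)
  pinnedPosition-successor t u<u' = trans (unpinned (successor u<u') (toℕ-successor u<u'))
                                          (position-successor t u<u')
    where
    unpinned : ∀ i {n} → toℕ i ≡ suc n → pinnedPosition t i ≡ position t i
    unpinned (Fin.suc i) _ = refl

  module _ {k : ℕ} {ψ : Coloring k (2 * suc m ∸ 1)} where

    type1-separated : Type1 (suc m) ψ → ∀ {t t'} → t Fin.< t' →
      Separated (restrict ψ (window t)) (restrict ψ (window t'))
    type1-separated (a , b , a≢b , path-a , middle-b) {t} {t'} t<t' =
      t , t⁺ , t<t⁺ , λ same → a≢b (trans (sym later) (trans (sym same) middle))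
      where
      t⁺ = successor t<t'
      t<t⁺ : t Fin.< t⁺
      t<t⁺ = ℕ.≤-reflexive (sym (toℕ-successor t<t'))
      toℕ-window : ∀ u i → toℕ (window u i) ≡ position u i
      toℕ-window u = toℕ-embed (position u) (position<2r-1 u)
      middle : ψ (window t t) (window t t⁺) ≡ b
      middle = middle-b _ _ (cong suc (trans (toℕ-window t t) (position-self t)))
        (trans (toℕ-window t t⁺) (trans (position-successor t t<t') (cong suc (position-self t))))
      later : ψ (window t' t) (window t' t⁺) ≡ a
      later = path-a _ _
        (trans (toℕ-window t' t⁺) (trans (position-successor t' t<t') (cong suc (sym (toℕ-window t' t)))))
        (s≤s (subst (ℕ._< m) (sym (toℕ-window t' t)) (position-earlier t<t')))

    type2-separated : Type2 (suc m) ψ → ∀ {t t'} → t Fin.< t' →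
      Separated (restrict ψ (pinnedWindow t)) (restrict ψ (pinnedWindow t'))
    type2-separated (a , b , a≢b , star-a , middle-b) {t} {t'} t<t' =
      Fin.zero , t⁺ , 0<t⁺ , λ same → a≢b (trans (sym later) (trans (sym same) middle))
      where
      t⁺ = successor t<t'
      0<t⁺ : Fin.zero {m} Fin.< t⁺
      0<t⁺ = subst (1 ≤_) (sym (toℕ-successor t<t')) (s≤s z≤n)
      toℕ-pinnedWindow : ∀ u i → toℕ (pinnedWindow u i) ≡ pinnedPosition u i
      toℕ-pinnedWindow u = toℕ-embed (pinnedPosition u) (pinnedPosition<2r-1 u)
      toℕ-pinnedWindow-t⁺ : ∀ u → toℕ (pinnedWindow u t⁺) ≡ suc (position u t)
      toℕ-pinnedWindow-t⁺ u = trans (toℕ-pinnedWindow u t⁺) (pinnedPosition-successor u t<t')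
      middle : ψ (pinnedWindow t Fin.zero) (pinnedWindow t t⁺) ≡ b
      middle = middle-b _ _ (toℕ-pinnedWindow t Fin.zero)
        (trans (toℕ-pinnedWindow-t⁺ t) (cong suc (position-self t)))
      later : ψ (pinnedWindow t' Fin.zero) (pinnedWindow t' t⁺) ≡ a
      later = star-a _ _ (toℕ-pinnedWindow t' Fin.zero)
        (subst (1 ≤_) (sym (toℕ-pinnedWindow-t⁺ t')) (s≤s z≤n))
        (subst (ℕ._< suc m) (sym (toℕ-pinnedWindow-t⁺ t')) (s≤s (position-earlier t<t')))

module _ {k : ℕ} {_≤P_ : Rel (Fin k) 0ℓ} (≤P-refl : Reflexive _≤P_) where

  restrict-embeds : ∀ {m n} (ψ : Coloring k m) {g : Fin n → Fin m} →
    g Preserves Fin._<_ ⟶ Fin._<_ → Embeds _≤P_ (restrict ψ g) ψ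
  restrict-embeds ψ {g} g-mono = g , (λ _ _ → g-mono) , λ _ _ _ → ≤P-refl

  reversal-reversal-embeds : ∀ {n} (χ : Coloring k n) → Embeds _≤P_ (reversal (reversal χ)) χ
  reversal-reversal-embeds χ = (λ i → i) , (λ _ _ i<j → i<j) ,
    λ i j _ → subst (_≤P χ i j) (sym (reversal-involutive χ i j)) ≤P-refl

  module _ {X : ∀ n → Coloring k n → Set} (ideal : IsIdeal _≤P_ X) where

    reversal∈Reversed : ∀ {n} {χ : Coloring k n} → X n χ → Reversed X n (reversal χ)
    reversal∈Reversed {n} {χ} = ideal n n _ χ (reversal-reversal-embeds χ)

    reversed-isIdeal : IsIdeal _≤P_ (Reversed X)
    reversed-isIdeal m n ψ χ (f , f-mono , ψ≤χf) = ideal m n (reversal ψ) (reversal χ)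
      ( opposite ∘ f ∘ opposite
      , (λ i j i<j → opposite-reverses-< (f-mono _ _ (opposite-reverses-< i<j)))
      , λ i j i<j → subst₂ (λ x y → ψ (opposite j) (opposite i) ≤P χ x y)
          (sym (Fin.opposite-involutive _)) (sym (Fin.opposite-involutive _))
          (ψ≤χf _ _ (opposite-reverses-< i<j)))

    largeSlice-windows : ∀ {n M} {ψ : Coloring k M} → X M ψ →
      (w : Fin n → Fin n → Fin M) → (∀ t → w t Preserves Fin._<_ ⟶ Fin._<_) →
      (∀ {t t'} → t Fin.< t' → Separated (restrict ψ (w t)) (restrict ψ (w t'))) →
      LargeSlice X n
    largeSlice-windows {ψ = ψ} ψ∈X w w-mono separated =
      (λ t → restrict ψ (w t)) , (λ t → ideal _ _ _ ψ (restrict-embeds ψ (w-mono t)) ψ∈X) , distinct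
      where
      distinct : ∀ t t' → t ≢ t' → ¬ (restrict ψ (w t) ≈C restrict ψ (w t'))
      distinct t t' t≢t' with Fin.<-cmp t t'
      ... | tri< t<t' _ _ = separated⇒≉ (separated t<t')
      ... | tri≈ _ t≡t' _ = λ _ → t≢t' t≡t'
      ... | tri> _ _ t'<t = λ w≈w' → separated⇒≉ (separated t'<t) (λ i j i<j → sym (w≈w' i j i<j))

    module _ {m : ℕ} {ψ : Coloring k (2 * suc m ∸ 1)} (ψ∈X : X (2 * suc m ∸ 1) ψ) where
      open Windows m

      largeSlice-type1 : Type1 (suc m) ψ → LargeSlice X (suc m)
      largeSlice-type1 ψ-type1 = largeSlice-windows ψ∈X window
        (λ t → embed-mono (position t) (position<2r-1 t) (position-mono t))
        (type1-separated ψ-type1)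

      largeSlice-type2 : Type2 (suc m) ψ → LargeSlice X (suc m)
      largeSlice-type2 ψ-type2 = largeSlice-windows ψ∈X pinnedWindow
        (λ t → embed-mono (pinnedPosition t) (pinnedPosition<2r-1 t) (pinnedPosition-mono t))
        (type2-separated ψ-type2)

  largeSlice-rich : ∀ {X} → IsIdeal _≤P_ X → ∀ {m} {ψ : Coloring k (2 * suc m ∸ 1)} →
    X (2 * suc m ∸ 1) ψ → Rich (suc m) ψ → LargeSlice X (suc m)
  largeSlice-rich {X} ideal ψ∈X (inj₁ type1) = largeSlice-type1 ideal ψ∈X type1
  largeSlice-rich {X} ideal ψ∈X (inj₂ (inj₁ type1ʳ)) = largeSlice-unreverse {X = X}
    (largeSlice-type1 (reversed-isIdeal ideal) (reversal∈Reversed ideal ψ∈X) type1ʳ)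
  largeSlice-rich {X} ideal ψ∈X (inj₂ (inj₂ (inj₁ type2))) = largeSlice-type2 ideal ψ∈X type2
  largeSlice-rich {X} ideal ψ∈X (inj₂ (inj₂ (inj₂ type2ʳ))) = largeSlice-unreverse {X = X}
    (largeSlice-type2 (reversed-isIdeal ideal) (reversal∈Reversed ideal ψ∈X) type2ʳ)

lemma3p2 : (k : ℕ) (_≤P_ : Rel (Fin k) 0ℓ) → IsPartialOrder _≡_ _≤P_ →
    (X : ∀ n → Coloring k n → Set) → IsIdeal _≤P_ X →
    (∀ r → 1 ≤ r → ∃[ χ ] (X (2 * r ∸ 1) χ × Rich r χ)) →
    ∀ n → 1 ≤ n →
      Σ (Fin n → Coloring k n) λ f → ((∀ (i : Fin n) → X n (f i))
             × (∀ (i j : Fin n) → i ≢ j → ¬ (f i ≈C f j)))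
lemma3p2 k _≤P_ isPartialOrder X ideal richExists (suc m) _
  with richExists (suc m) (s≤s z≤n)
... | ψ , ψ∈X , ψ-rich =
  largeSlice-rich {_≤P_ = _≤P_} (IsPartialOrder.refl isPartialOrder) ideal ψ∈X ψ-rich
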